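{- A function $f:[0,1]^n\to[0,1]$ is representable by a system of conditioned linear expressions if and only if its graph $\{(\vec x,y)\in[0,1]^{n+1}\mid f(\vec x)=y\}$ is definable by a formula $F(x_1,\dots,x_n,y)$ of the first-order theory of rational linear arithmetic. Moreover, a defining formula can be computed from a representing system, and a representing system can be computed from a defining formula.
   Context: A (rational) linear expression in $x_1,\dots,x_n$ is $q_1x_1+\dots+q_nx_n+q$ with rational $q_i,q$. The first-order theory of rational linear arithmetic has linear expressions as terms, atomic formulas $e_1<e_2$, $e_1\le e_2$, interpreted over the reals. A conditioned linear expression $C\vdash e$ consists of a linear expression $e$ and a finite set $C$ of inequalities $e_1<e_2$ or $e_1\le e_2$ between linear expressions; $C(\vec r)$ denotes the conjunction of these inequalities instantiated at $\vec r$. A system (finite set) $\mathcal F$ of conditioned linear expressions in $x_1,\dots,x_n$ represents $f:[0,1]^n\to[0,1]$ if (1) for every $\vec d\in[0,1]^n$ there is $(C\vdash e)\in\mathcal F$ with $C(\vec d)$ true, and (2) for every $\vec d\in[0,1]^n$ and $(C\vdash e)\in\mathcal F$, if $C(\vec d)$ is true then $e(\vec d)=f(\vec d)$. -}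

module Defs where

open import Level using (0ℓ)
open import Data.Nat using (ℕ; zero; suc)
open import Data.Integer using (ℤ; +_; -[1+_])
open import Data.Rational using (ℚ; ↥_; ↧ₙ_)
open import Data.Fin using (Fin)
open import Data.List using (List)
open import Data.List.Relation.Unary.All using (All)
open import Data.List.Membership.Propositional using (_∈_)
open import Data.Product using (Σ; ∃; _×_; _,_)
open import Data.Sum using (_⊎_)
open import Data.Empty using (⊥)
open import Function.Bundles using (_⇔_)
open import Relation.Nullary using (¬_)
open import Relation.Binary.PropositionalEquality using (_≡_; _≢_)
open import Algebra.Structures using (IsCommutativeRing)
open import Relation.Binary.Structures using (IsStrictTotalOrder)

-- The real numbers, given axiomatically: a Dedekind-complete ordered
-- field (unique up to isomorphism).  The order is required to be a
-- strict total order in the stdlib sense (with a trichotomy function),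
-- which is classically true of ℝ.

record Reals : Set₁ where
  infixl 6 _+_
  infixl 7 _*_
  infix 4 _<_ _≤_
  field
    ℝ      : Set
    _+_    : ℝ → ℝ → ℝ
    _*_    : ℝ → ℝ → ℝ
    -_     : ℝ → ℝ
    0ℝ     : ℝ
    1ℝ     : ℝ
    _⁻¹    : ℝ → ℝ
    _<_    : ℝ → ℝ → Set
    isCommutativeRing : IsCommutativeRing _≡_ _+_ _*_ -_ 0ℝ 1ℝ
    0≢1    : 0ℝ ≢ 1ℝ
    ⁻¹-inverse : ∀ x → x ≢ 0ℝ → x * (x ⁻¹) ≡ 1ℝ
    isStrictTotalOrder : IsStrictTotalOrder _≡_ _<_
    +-mono-< : ∀ x y z → x < y → x + z < y + z
    *-pos    : ∀ x y → 0ℝ < x → 0ℝ < y → 0ℝ < x * y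

  _≤_ : ℝ → ℝ → Set
  x ≤ y = (x < y) ⊎ (x ≡ y)

  field
    complete : (P : ℝ → Set) → ∃ P → (∃ λ b → ∀ x → P x → x ≤ b) →
               ∃ λ s → (∀ x → P x → x ≤ s) × (∀ b → (∀ x → P x → x ≤ b) → s ≤ b)

  fromℕ : ℕ → ℝ
  fromℕ zero    = 0ℝ
  fromℕ (suc n) = 1ℝ + fromℕ n

  fromℤ : ℤ → ℝ
  fromℤ (+ n)     = fromℕ n
  fromℤ -[1+ n ]  = - fromℕ (suc n)

  fromℚ : ℚ → ℝ
  fromℚ q = fromℤ (↥ q) * (fromℕ (↧ₙ q) ⁻¹)

  sumℝ : ∀ {n} → (Fin n → ℝ) → ℝ
  sumℝ {zero}  v = 0ℝ
  sumℝ {suc n} v = v Fin.zero + sumℝ (λ i → v (Fin.suc i))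

  In01 : ℝ → Set
  In01 x = (0ℝ ≤ x) × (x ≤ 1ℝ)

  InCube : ∀ {n} → (Fin n → ℝ) → Set
  InCube {n} x = ∀ (i : Fin n) → In01 (x i)

record LinExp (m : ℕ) : Set where
  constructor linexp
  field
    coeff : Fin m → ℚ
    const : ℚ

data Ineq (m : ℕ) : Set where
  _<ᵉ_ : LinExp m → LinExp m → Ineq m
  _≤ᵉ_ : LinExp m → LinExp m → Ineq m

-- First-order formulas of rational linear arithmetic with m free
-- variables (de Bruijn: a quantifier binds variable 0 and shifts the rest).
data Formula (m : ℕ) : Set where
  atom : Ineq m → Formula m
  ¬ᶠ_  : Formula m → Formula m
  _∧ᶠ_ : Formula m → Formula m → Formula m
  _∨ᶠ_ : Formula m → Formula m → Formula m
  ∃ᶠ   : Formula (suc m) → Formula m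
  ∀ᶠ   : Formula (suc m) → Formula m

record CondExp (n : ℕ) : Set where
  constructor _⊢_
  field
    cond : List (Ineq n)
    expr : LinExp n

System : ℕ → Set
System n = List (CondExp n)

module Semantics (R : Reals) where
  open Reals R

  _∷ᵛ_ : ∀ {m} → ℝ → (Fin m → ℝ) → (Fin (suc m) → ℝ)
  (x ∷ᵛ ρ) Fin.zero    = x
  (x ∷ᵛ ρ) (Fin.suc i) = ρ i

  evalE : ∀ {m} → LinExp m → (Fin m → ℝ) → ℝ
  evalE (linexp c q) ρ = sumℝ (λ i → fromℚ (c i) * ρ i) + fromℚ q

  evalI : ∀ {m} → Ineq m → (Fin m → ℝ) → Set
  evalI (e₁ <ᵉ e₂) ρ = evalE e₁ ρ < evalE e₂ ρ
  evalI (e₁ ≤ᵉ e₂) ρ = evalE e₁ ρ ≤ evalE e₂ ρ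

  ⟦_⟧ : ∀ {m} → Formula m → (Fin m → ℝ) → Set
  ⟦ atom a ⟧  ρ = evalI a ρ
  ⟦ ¬ᶠ φ ⟧    ρ = ¬ ⟦ φ ⟧ ρ
  ⟦ φ ∧ᶠ ψ ⟧  ρ = ⟦ φ ⟧ ρ × ⟦ ψ ⟧ ρ
  ⟦ φ ∨ᶠ ψ ⟧  ρ = ⟦ φ ⟧ ρ ⊎ ⟦ ψ ⟧ ρ
  ⟦ ∃ᶠ φ ⟧    ρ = Σ ℝ λ x → ⟦ φ ⟧ (x ∷ᵛ ρ)
  ⟦ ∀ᶠ φ ⟧    ρ = (x : ℝ) → ⟦ φ ⟧ (x ∷ᵛ ρ)

  HoldsC : ∀ {n} → List (Ineq n) → (Fin n → ℝ) → Set
  HoldsC C d = All (λ a → evalI a d) C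

  -- f : [0,1]ⁿ → [0,1], encoded as a total function on ℝⁿ whose values
  -- on the cube lie in [0,1] (values off the cube are irrelevant).
  MapsCube : ∀ {n} → ((Fin n → ℝ) → ℝ) → Set
  MapsCube {n} f = ∀ (d : Fin n → ℝ) → InCube d → In01 (f d)

  Represents : ∀ {n} → ((Fin n → ℝ) → ℝ) → System n → Set
  Represents {n} f 𝓕 =
    (∀ (d : Fin n → ℝ) → InCube d → ∃ λ c → (c ∈ 𝓕) × HoldsC (CondExp.cond c) d)
    × (∀ (d : Fin n → ℝ) → InCube d → ∀ c → c ∈ 𝓕 → HoldsC (CondExp.cond c) d →
         evalE (CondExp.expr c) d ≡ f d)

  -- F(x₁,…,xₙ,y) defines the graph {(x,y) ∈ [0,1]ⁿ⁺¹ | f x = y}.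
  -- The variable y is variable 0 of F, x_i is variable (suc i).
  Defines : ∀ {n} → ((Fin n → ℝ) → ℝ) → Formula (suc n) → Set
  Defines {n} f F = ∀ (x : Fin n → ℝ) (y : ℝ) →
    ⟦ F ⟧ (y ∷ᵛ x) ⇔ (InCube x × In01 y × (f x ≡ y))

  RepresentableBySystem : ∀ {n} → ((Fin n → ℝ) → ℝ) → Set
  RepresentableBySystem {n} f = ∃ λ (𝓕 : System n) → Represents f 𝓕

  GraphDefinable : ∀ {n} → ((Fin n → ℝ) → ℝ) → Set
  GraphDefinable {n} f = ∃ λ (F : Formula (suc n)) → Defines f F

-- A system 𝓕 yields a defining formula directly: (x, y) lies on the graph iff x and y lie
-- in the unit cube and some branch C ⊢ e of 𝓕 has C(x) and y = e(x).
--
-- Conversely, a defining formula F is first made quantifier-free by Ferrante–Rackoff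
-- elimination. Whether a quantifier-free ψ(y, x) holds depends only on the side on which y
-- lies of each root t(x) of its atoms, so ∃ y. ψ is the disjunction of ψ(t, x) over the test
-- points t: the roots, the roots ± 1, the midpoints of pairs of roots, and 0.  The same test
-- points give a representing system, with branches D ⊢ t for D a disjunct of the DNF of
-- ψ(t, x).  A branch D ⊢ t that applies at x has ψ(t(x), x), hence t(x) = f(x) because F
-- defines the graph of f; and some branch applies, because ψ(f(x), x) holds and hence so does
-- ψ(t, x) for a test point t in the same cell as f(x).

module Submission where

open import Defs
open import Level using (0ℓ)
open import Function using (_∘_; id)
open import Function.Bundles using (_⇔_; mk⇔; module Equivalence)
open import Function.Properties.Equivalence using (⇔-isEquivalence)
open import Data.Empty using (⊥-elim)
open import Data.Product as Product using (Σ; ∃; _×_; _,_; proj₁; proj₂)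
open import Data.Product.Function.NonDependent.Propositional using (_×-⇔_)
open import Data.Sum as Sum using (_⊎_; inj₁; inj₂; [_,_]′)
open import Data.Sum.Function.Propositional using (_⊎-⇔_)
open import Data.Maybe using (Maybe; just; nothing)
open import Data.Nat using (ℕ; zero; suc)
import Data.Nat as ℕ
import Data.Nat.Properties as ℕ
open import Data.Integer using (+[1+_]; -[1+_]; _◃_; _⊖_; ∣_∣)
import Data.Integer as ℤ
import Data.Integer.Properties as ℤ
open import Data.Sign as Sign using (Sign)
open import Data.Rational as ℚ using (ℚ; mkℚ; 0ℚ; 1ℚ; ½)
import Data.Rational.Properties as ℚ
open import Data.Rational.Unnormalised as ℚᵘ using (ℚᵘ; mkℚᵘ; *≡*)
open import Data.Fin using (Fin; zero; suc)
import Data.Vec.Functional as Vector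
open import Data.List using (List; []; _∷_; _++_; map; foldr; concatMap; cartesianProductWith; tabulate)
open import Data.List.Relation.Unary.All as All using (All; []; _∷_)
import Data.List.Relation.Unary.All.Properties as All
import Data.List.Relation.Unary.All.Properties.Core as All
open import Data.List.Relation.Unary.Any as Any using (Any; here; there; any?)
open import Data.List.Relation.Unary.Any.Properties
  using (++⁺ˡ; ++⁺ʳ; ++⁻; map⁺; map⁻; concatMap⁺; cartesianProductWith⁺; cartesianProductWith⁻)
open import Data.List.Membership.Propositional using (_∈_; lose; find)
open import Data.List.Membership.Propositional.Properties
  using (∈-++⁺ˡ; ∈-++⁺ʳ; ∈-map⁺; ∈-map⁻; ∈-cartesianProductWith⁺; ∈-concatMap⁻)
open import Relation.Nullary using (¬_; Dec; yes; no)
open import Relation.Nullary.Decidable using (_×-dec_; _⊎-dec_; decidable-stable)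
open import Relation.Binary using (Rel; tri<; tri≈; tri>)
open import Relation.Binary.Structures using (IsStrictTotalOrder; IsEquivalence)
import Relation.Binary.Construct.Flip.Ord as Flip
import Relation.Binary.Construct.StrictToNonStrict as StrictToNonStrict
open import Relation.Binary.PropositionalEquality
  using (_≡_; _≢_; refl; sym; trans; cong; cong₂; subst; subst₂; module ≡-Reasoning)
open import Algebra.Bundles using (CommutativeRing)
import Algebra.Solver.Ring.AlmostCommutativeRing as AlmostCommutativeRing

open Equivalence using (to; from)

private
  variable
    m n : ℕ

  module ⇔ = IsEquivalence (⇔-isEquivalence {0ℓ})

data Comparison : Set where
  less equal greater : Comparison

reverse : Comparison → Comparison
reverse less    = greater
reverse equal   = equal
reverse greater = less

module GreatestBelow {a b ℓ₁ ℓ₂} {A : Set a} {B : Set b} {_≈_ : Rel A ℓ₁} {_<_ : Rel A ℓ₂}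
  (sto : IsStrictTotalOrder _≈_ _<_) (f : B → A) where

  open IsStrictTotalOrder sto using (compare; _<?_; <-respˡ-≈; module Eq) renaming (trans to <-trans)
  open StrictToNonStrict _≈_ _<_ using (_≤_)

  greatestBelow : ∀ y ts → All (λ u → ¬ f u < y) ts
    ⊎ ∃ λ l → l ∈ ts × f l < y × All (λ u → f u < y → f u ≤ f l) ts
  greatestBelow y [] = inj₁ []
  greatestBelow y (t ∷ ts) with f t <? y | greatestBelow y ts
  ... | no t≮y | inj₁ none = inj₁ (t≮y ∷ none)
  ... | no t≮y | inj₂ (l , l∈ , l<y , max) = inj₂ (l , there l∈ , l<y , (⊥-elim ∘ t≮y) ∷ max)
  ... | yes t<y | inj₁ none =
    inj₂ (t , here refl , t<y , (λ _ → inj₂ Eq.refl) ∷ All.map (λ u≮y → ⊥-elim ∘ u≮y) none)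
  ... | yes t<y | inj₂ (l , l∈ , l<y , max) with compare (f t) (f l)
  ...   | tri< t<l _ _ = inj₂ (l , there l∈ , l<y , (λ _ → inj₁ t<l) ∷ max)
  ...   | tri≈ _ t≈l _ = inj₂ (l , there l∈ , l<y , (λ _ → inj₂ t≈l) ∷ max)
  ...   | tri> _ _ l<t =
    inj₂ (t , here refl , t<y , (λ _ → inj₂ Eq.refl) ∷ All.map (λ u≤l u<y → inj₁ (≤-<-trans (u≤l u<y) l<t)) max)
    where
    ≤-<-trans : ∀ {x y z} → x ≤ y → y < z → x < z
    ≤-<-trans = StrictToNonStrict.≤-<-trans _≈_ _<_ Eq.sym <-trans <-respˡ-≈

module StrictTotalOrderProperties {a ℓ} {A : Set a} {_<_ : Rel A ℓ} (sto : IsStrictTotalOrder _≡_ _<_) where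

  open IsStrictTotalOrder sto using (compare; irrefl; asym; isEquivalence; <-respˡ-≈; <-respʳ-≈)
    renaming (trans to <-trans)
  open StrictToNonStrict _≡_ _<_ public using (_≤_)

  private
    variable
      x y z u v : A

  <-≤-trans : x < y → y ≤ z → x < z
  <-≤-trans = StrictToNonStrict.<-≤-trans _≡_ _<_ <-trans <-respʳ-≈

  ≤-<-trans : x ≤ y → y < z → x < z
  ≤-<-trans = StrictToNonStrict.≤-<-trans _≡_ _<_ sym <-trans <-respˡ-≈

  ≤-antisym : x ≤ y → y ≤ x → x ≡ y
  ≤-antisym = StrictToNonStrict.antisym _≡_ _<_ isEquivalence <-trans irrefl

  ≮⇒≥ : ∀ {x y} → ¬ x < y → y ≤ x
  ≮⇒≥ {x} {y} x≮y with compare x y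
  ... | tri< x<y _ _  = ⊥-elim (x≮y x<y)
  ... | tri≈ _ x≡y _  = inj₂ (sym x≡y)
  ... | tri> _ _ y<x  = inj₁ y<x

  ≤⇒≯ : y ≤ x → ¬ x < y
  ≤⇒≯ (inj₁ y<x) x<y  = asym x<y y<x
  ≤⇒≯ (inj₂ refl) x<x = irrefl refl x<x

  ≰⇒> : ∀ {x y} → ¬ x ≤ y → y < x
  ≰⇒> {x} {y} x≰y with compare x y
  ... | tri< x<y _ _ = ⊥-elim (x≰y (inj₁ x<y))
  ... | tri≈ _ x≡y _ = ⊥-elim (x≰y (inj₂ x≡y))
  ... | tri> _ _ y<x = y<x

  <⇒≱ : y < x → ¬ x ≤ y
  <⇒≱ y<x x≤y = irrefl refl (≤-<-trans x≤y y<x)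

  cmp : A → A → Comparison
  cmp x y with compare x y
  ... | tri< _ _ _ = less
  ... | tri≈ _ _ _ = equal
  ... | tri> _ _ _ = greater

  cmp-< : ∀ {x y} → x < y → cmp x y ≡ less
  cmp-< {x} {y} x<y with compare x y
  ... | tri< _ _ _    = refl
  ... | tri≈ x≮y _ _  = ⊥-elim (x≮y x<y)
  ... | tri> x≮y _ _  = ⊥-elim (x≮y x<y)

  cmp-≡ : ∀ {x y} → x ≡ y → cmp x y ≡ equal
  cmp-≡ {x} {y} x≡y with compare x y
  ... | tri< _ x≢y _  = ⊥-elim (x≢y x≡y)
  ... | tri≈ _ _ _    = refl
  ... | tri> _ x≢y _  = ⊥-elim (x≢y x≡y)

  cmp-> : ∀ {x y} → y < x → cmp x y ≡ greater
  cmp-> {x} {y} y<x with compare x y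
  ... | tri< _ _ y≮x  = ⊥-elim (y≮x y<x)
  ... | tri≈ _ _ y≮x  = ⊥-elim (y≮x y<x)
  ... | tri> _ _ _    = refl

  cmp≡less⇒< : ∀ {x y} → cmp x y ≡ less → x < y
  cmp≡less⇒< {x} {y} eq with compare x y
  ... | tri< x<y _ _ = x<y

  cmp≡equal⇒≡ : ∀ {x y} → cmp x y ≡ equal → x ≡ y
  cmp≡equal⇒≡ {x} {y} eq with compare x y
  ... | tri≈ _ x≡y _ = x≡y

  cmp-resp-< : cmp x y ≡ cmp u v → x < y → u < v
  cmp-resp-< eq x<y = cmp≡less⇒< (trans (sym eq) (cmp-< x<y))

  cmp-resp-≤ : cmp x y ≡ cmp u v → x ≤ y → u ≤ v
  cmp-resp-≤ eq (inj₁ x<y) = inj₁ (cmp-resp-< eq x<y)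
  cmp-resp-≤ eq (inj₂ x≡y) = inj₂ (cmp≡equal⇒≡ (trans (sym eq) (cmp-≡ x≡y)))

  cmp-monotone : ∀ {g : A → A} → (∀ {x y} → x < y → g x < g y) → ∀ x y → cmp (g x) (g y) ≡ cmp x y
  cmp-monotone mono x y with compare x y
  ... | tri< x<y _ _  = cmp-< (mono x<y)
  ... | tri≈ _ refl _ = cmp-≡ refl
  ... | tri> _ _ y<x  = cmp-> (mono y<x)

  cmp-antitone : ∀ {g : A → A} → (∀ {x y} → x < y → g y < g x) → ∀ x y → cmp (g x) (g y) ≡ reverse (cmp x y)
  cmp-antitone anti x y with compare x y
  ... | tri< x<y _ _  = cmp-> (anti x<y)
  ... | tri≈ _ refl _ = cmp-≡ refl
  ... | tri> _ _ y<x  = cmp-< (anti y<x)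

  sameSide : ∀ {x y z} → x ≢ y → (x < y → x < z) → (y < x → z < x) → cmp x y ≡ cmp x z
  sameSide {x} {y} x≢y below above with compare x y
  ... | tri< x<y _ _ = sym (cmp-< (below x<y))
  ... | tri≈ _ x≡y _ = ⊥-elim (x≢y x≡y)
  ... | tri> _ _ y<x = sym (cmp-> (above y<x))

  module _ {b} {B : Set b} (f : B → A) where

    open GreatestBelow sto f public

    -- the least element above y is the greatest one below y in the reversed order
    leastAbove : ∀ y ts → All (λ u → ¬ y < f u) ts
      ⊎ ∃ λ k → k ∈ ts × y < f k × All (λ u → y < f u → f k ≤ f u) ts
    leastAbove = GreatestBelow.greatestBelow (Flip.isStrictTotalOrder sto) f

module RealArithmetic (R : Reals) where

  open Reals R
  open ≡-Reasoning

  commutativeRing : CommutativeRing 0ℓ 0ℓ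
  commutativeRing = record { isCommutativeRing = isCommutativeRing }

  open CommutativeRing commutativeRing public
    using ( +-assoc; +-comm; *-assoc; *-comm; +-identityˡ; +-identityʳ; *-identityˡ; *-identityʳ
          ; zeroˡ; zeroʳ; distribˡ; distribʳ; -‿inverseʳ)
  open CommutativeRing commutativeRing
    using (ring; semiring; +-abelianGroup; +-commutativeSemigroup; *-commutativeSemigroup)
  open import Algebra.Properties.Ring ring public using (-1*x≈-x; -‿involutive; -0#≈0#; -‿distribˡ-*)
  open import Algebra.Properties.AbelianGroup +-abelianGroup using (⁻¹-∙-comm)
  open import Algebra.Properties.CommutativeSemigroup +-commutativeSemigroup public
    using () renaming (interchange to +-interchange)
  open import Algebra.Properties.CommutativeSemigroup *-commutativeSemigroup
    using () renaming (interchange to *-interchange)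
  open import Algebra.Properties.Semiring.Mult semiring using (×-homo-+; ×1-homo-*) renaming (_×_ to _·_)

  fromℕ≡×1 : ∀ n → fromℕ n ≡ n · 1ℝ
  fromℕ≡×1 zero    = refl
  fromℕ≡×1 (suc n) = cong (1ℝ +_) (fromℕ≡×1 n)

  fromℕ-+ : ∀ m n → fromℕ (m ℕ.+ n) ≡ fromℕ m + fromℕ n
  fromℕ-+ m n = begin
    fromℕ (m ℕ.+ n)       ≡⟨ fromℕ≡×1 (m ℕ.+ n) ⟩
    (m ℕ.+ n) · 1ℝ        ≡⟨ ×-homo-+ 1ℝ m n ⟩
    m · 1ℝ + n · 1ℝ       ≡⟨ sym (cong₂ _+_ (fromℕ≡×1 m) (fromℕ≡×1 n)) ⟩
    fromℕ m + fromℕ n     ∎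

  fromℕ-* : ∀ m n → fromℕ (m ℕ.* n) ≡ fromℕ m * fromℕ n
  fromℕ-* m n = begin
    fromℕ (m ℕ.* n)       ≡⟨ fromℕ≡×1 (m ℕ.* n) ⟩
    (m ℕ.* n) · 1ℝ        ≡⟨ ×1-homo-* m n ⟩
    m · 1ℝ * n · 1ℝ       ≡⟨ sym (cong₂ _*_ (fromℕ≡×1 m) (fromℕ≡×1 n)) ⟩
    fromℕ m * fromℕ n     ∎

  signℝ : Sign → ℝ
  signℝ Sign.+ = 1ℝ
  signℝ Sign.- = - 1ℝ

  signℝ-* : ∀ s t → signℝ (s Sign.* t) ≡ signℝ s * signℝ t
  signℝ-* Sign.+ t      = sym (*-identityˡ _)
  signℝ-* Sign.- Sign.+ = sym (*-identityʳ _)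
  signℝ-* Sign.- Sign.- = sym (trans (-1*x≈-x _) (-‿involutive _))

  fromℤ-◃ : ∀ s n → fromℤ (s ◃ n) ≡ signℝ s * fromℕ n
  fromℤ-◃ s      zero    = sym (zeroʳ _)
  fromℤ-◃ Sign.+ (suc n) = sym (*-identityˡ _)
  fromℤ-◃ Sign.- (suc n) = sym (-1*x≈-x _)

  fromℤ≡sign*abs : ∀ i → fromℤ i ≡ signℝ (ℤ.sign i) * fromℕ ∣ i ∣
  fromℤ≡sign*abs i = trans (cong fromℤ (sym (ℤ.◃-inverse i))) (fromℤ-◃ (ℤ.sign i) ∣ i ∣)

  fromℤ-* : ∀ i j → fromℤ (i ℤ.* j) ≡ fromℤ i * fromℤ j
  fromℤ-* i j = begin
    fromℤ ((ℤ.sign i Sign.* ℤ.sign j) ◃ (∣ i ∣ ℕ.* ∣ j ∣))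
      ≡⟨ fromℤ-◃ (ℤ.sign i Sign.* ℤ.sign j) (∣ i ∣ ℕ.* ∣ j ∣) ⟩
    signℝ (ℤ.sign i Sign.* ℤ.sign j) * fromℕ (∣ i ∣ ℕ.* ∣ j ∣)
      ≡⟨ cong₂ _*_ (signℝ-* (ℤ.sign i) (ℤ.sign j)) (fromℕ-* ∣ i ∣ ∣ j ∣) ⟩
    (signℝ (ℤ.sign i) * signℝ (ℤ.sign j)) * (fromℕ ∣ i ∣ * fromℕ ∣ j ∣)
      ≡⟨ *-interchange _ _ _ _ ⟩
    (signℝ (ℤ.sign i) * fromℕ ∣ i ∣) * (signℝ (ℤ.sign j) * fromℕ ∣ j ∣)
      ≡⟨ sym (cong₂ _*_ (fromℤ≡sign*abs i) (fromℤ≡sign*abs j)) ⟩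
    fromℤ i * fromℤ j ∎

  fromℤ-neg : ∀ i → fromℤ (ℤ.- i) ≡ - fromℤ i
  fromℤ-neg -[1+ n ]    = sym (-‿involutive _)
  fromℤ-neg (ℤ.+ zero)    = sym -0#≈0#
  fromℤ-neg +[1+ n ]    = refl

  neg-+ : ∀ x y → - (x + y) ≡ - x + - y
  neg-+ x y = sym (⁻¹-∙-comm x y)

  fromℤ-⊖ : ∀ m n → fromℤ (m ⊖ n) ≡ fromℕ m + - fromℕ n
  fromℤ-⊖ m       zero    = sym (trans (cong (fromℕ m +_) -0#≈0#) (+-identityʳ _))
  fromℤ-⊖ zero    (suc n) = sym (+-identityˡ _)
  fromℤ-⊖ (suc m) (suc n) = begin
    fromℤ (suc m ⊖ suc n)                ≡⟨ cong fromℤ (ℤ.[1+m]⊖[1+n]≡m⊖n m n) ⟩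
    fromℤ (m ⊖ n)                        ≡⟨ fromℤ-⊖ m n ⟩
    fromℕ m + - fromℕ n                  ≡⟨ sym (+-identityˡ _) ⟩
    0ℝ + (fromℕ m + - fromℕ n)           ≡⟨ cong (_+ (fromℕ m + - fromℕ n)) (sym (-‿inverseʳ 1ℝ)) ⟩
    (1ℝ + - 1ℝ) + (fromℕ m + - fromℕ n)  ≡⟨ +-interchange 1ℝ (- 1ℝ) (fromℕ m) (- fromℕ n) ⟩
    (1ℝ + fromℕ m) + (- 1ℝ + - fromℕ n)  ≡⟨ cong ((1ℝ + fromℕ m) +_) (sym (neg-+ 1ℝ (fromℕ n))) ⟩
    fromℕ (suc m) + - fromℕ (suc n)      ∎

  fromℤ-+ : ∀ i j → fromℤ (i ℤ.+ j) ≡ fromℤ i + fromℤ j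
  fromℤ-+ -[1+ m ] -[1+ n ] = begin
    - fromℕ (suc (suc (m ℕ.+ n)))        ≡⟨ cong (λ k → - fromℕ (suc k)) (sym (ℕ.+-suc m n)) ⟩
    - fromℕ (suc m ℕ.+ suc n)            ≡⟨ cong -_ (fromℕ-+ (suc m) (suc n)) ⟩
    - (fromℕ (suc m) + fromℕ (suc n))    ≡⟨ neg-+ _ _ ⟩
    - fromℕ (suc m) + - fromℕ (suc n)    ∎
  fromℤ-+ -[1+ m ] (ℤ.+ n)  = trans (fromℤ-⊖ n (suc m)) (+-comm _ _)
  fromℤ-+ (ℤ.+ m)  -[1+ n ] = fromℤ-⊖ m (suc n)
  fromℤ-+ (ℤ.+ m)  (ℤ.+ n)  = fromℕ-+ m n

  almostCommutativeRing : AlmostCommutativeRing.AlmostCommutativeRing 0ℓ 0ℓ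
  almostCommutativeRing = AlmostCommutativeRing.fromCommutativeRing commutativeRing

  fromℤ-homomorphism : ℤ.+-*-rawRing AlmostCommutativeRing.-Raw-AlmostCommutative⟶ almostCommutativeRing
  fromℤ-homomorphism = record
    { ⟦_⟧ = fromℤ ; +-homo = fromℤ-+ ; *-homo = fromℤ-* ; -‿homo = fromℤ-neg
    ; 0-homo = refl ; 1-homo = +-identityʳ 1ℝ }

  fromℤ-≟ : ∀ i j → Maybe (fromℤ i ≡ fromℤ j)
  fromℤ-≟ i j with i ℤ.≟ j
  ... | yes refl = just refl
  ... | no _     = nothing

  open import Algebra.Solver.Ring ℤ.+-*-rawRing almostCommutativeRing fromℤ-homomorphism fromℤ-≟ public
    using (solve; _:=_; _:+_; _:*_; _:-_; :-_)

  open StrictTotalOrderProperties isStrictTotalOrder public hiding (_≤_)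
  open IsStrictTotalOrder isStrictTotalOrder public using (compare; irrefl; asym; _<?_; _≟_)
    renaming (trans to <-trans)

  +-monoˡ-< : ∀ z {x y} → x < y → x + z < y + z
  +-monoˡ-< z {x} {y} = +-mono-< x y z

  +-monoʳ-< : ∀ z {x y} → x < y → z + x < z + y
  +-monoʳ-< z {x} {y} x<y = subst₂ _<_ (+-comm x z) (+-comm y z) (+-monoˡ-< z x<y)

  x<y⇒0<y-x : ∀ {x y} → x < y → 0ℝ < y + - x
  x<y⇒0<y-x {x} x<y = subst (_< _) (-‿inverseʳ x) (+-monoˡ-< (- x) x<y)

  0<y-x⇒x<y : ∀ {x y} → 0ℝ < y + - x → x < y
  0<y-x⇒x<y {x} {y} 0<y-x =
    subst₂ _<_ (+-identityˡ x) (solve 2 (λ x y → y :- x :+ x := y) refl x y) (+-monoˡ-< x 0<y-x)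

  neg-antimono-< : ∀ {x y} → x < y → - y < - x
  neg-antimono-< {x} {y} x<y =
    0<y-x⇒x<y (subst (0ℝ <_) (solve 2 (λ x y → y :- x := :- x :- (:- y)) refl x y) (x<y⇒0<y-x x<y))

  *-monoʳ-<-pos : ∀ {a x y} → 0ℝ < a → x < y → a * x < a * y
  *-monoʳ-<-pos {a} {x} {y} 0<a x<y = 0<y-x⇒x<y
    (subst (0ℝ <_) (solve 3 (λ a x y → a :* (y :- x) := a :* y :- a :* x) refl a x y) (*-pos _ _ 0<a (x<y⇒0<y-x x<y)))

  *-monoʳ-<-neg : ∀ {a x y} → a < 0ℝ → x < y → a * y < a * x
  *-monoʳ-<-neg {a} {x} {y} a<0 x<y =
    subst₂ _<_ (negate-twice y) (negate-twice x) (neg-antimono-< (*-monoʳ-<-pos 0<-a x<y))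
    where
    0<-a : 0ℝ < - a
    0<-a = subst (_< - a) -0#≈0# (neg-antimono-< a<0)
    negate-twice : ∀ z → - (- a * z) ≡ a * z
    negate-twice z = trans (cong -_ (sym (-‿distribˡ-* a z))) (-‿involutive (a * z))

  0<1 : 0ℝ < 1ℝ
  0<1 with compare 0ℝ 1ℝ
  ... | tri< 0<1 _ _ = 0<1
  ... | tri≈ _ 0≡1 _ = ⊥-elim (0≢1 0≡1)
  ... | tri> _ _ 1<0 = ⊥-elim (asym 1<0 (subst (0ℝ <_) square-1 (*-pos _ _ 0<-1 0<-1)))
    where
    0<-1 : 0ℝ < - 1ℝ
    0<-1 = subst (_< - 1ℝ) -0#≈0# (neg-antimono-< 1<0)
    square-1 : - 1ℝ * - 1ℝ ≡ 1ℝ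
    square-1 = trans (-1*x≈-x (- 1ℝ)) (-‿involutive 1ℝ)

  x<x+1 : ∀ x → x < x + 1ℝ
  x<x+1 x = subst (_< x + 1ℝ) (+-identityʳ x) (+-monoʳ-< x 0<1)

  x-1<x : ∀ x → x + - 1ℝ < x
  x-1<x x = subst (x + - 1ℝ <_) (+-identityʳ x) (+-monoʳ-< x (subst (- 1ℝ <_) -0#≈0# (neg-antimono-< 0<1)))

  0<fromℕ-suc : ∀ n → 0ℝ < fromℕ (suc n)
  0<fromℕ-suc zero    = subst (0ℝ <_) (sym (+-identityʳ 1ℝ)) 0<1
  0<fromℕ-suc (suc n) =
    <-trans (0<fromℕ-suc n) (subst (_< fromℕ (suc (suc n))) (+-identityˡ _) (+-monoˡ-< (fromℕ (suc n)) 0<1))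

  x≢0 : ∀ {x} → 0ℝ < x → x ≢ 0ℝ
  x≢0 0<x x≡0 = irrefl (sym x≡0) 0<x

  ⁻¹-pos : ∀ {x} → 0ℝ < x → 0ℝ < x ⁻¹
  ⁻¹-pos {x} 0<x with compare 0ℝ (x ⁻¹)
  ... | tri< 0<x⁻¹ _ _ = 0<x⁻¹
  ... | tri≈ _ 0≡x⁻¹ _ = ⊥-elim (0≢1 (begin
    0ℝ         ≡⟨ sym (zeroʳ x) ⟩
    x * 0ℝ     ≡⟨ cong (x *_) 0≡x⁻¹ ⟩
    x * x ⁻¹   ≡⟨ ⁻¹-inverse x (x≢0 0<x) ⟩
    1ℝ         ∎))
  ... | tri> _ _ x⁻¹<0 = ⊥-elim (asym 0<1
    (subst₂ _<_ (⁻¹-inverse x (x≢0 0<x)) (zeroʳ x) (*-monoʳ-<-pos 0<x x⁻¹<0)))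

  ⁻¹-unique : ∀ x y → x ≢ 0ℝ → x * y ≡ 1ℝ → y ≡ x ⁻¹
  ⁻¹-unique x y x≢0 xy≡1 = begin
    y                ≡⟨ sym (*-identityʳ y) ⟩
    y * 1ℝ           ≡⟨ cong (y *_) (sym (⁻¹-inverse x x≢0)) ⟩
    y * (x * x ⁻¹)   ≡⟨ solve 3 (λ y x i → y :* (x :* i) := (x :* y) :* i) refl y x (x ⁻¹) ⟩
    (x * y) * x ⁻¹   ≡⟨ cong (_* x ⁻¹) xy≡1 ⟩
    1ℝ * x ⁻¹        ≡⟨ *-identityˡ _ ⟩
    x ⁻¹             ∎

  private
    den : ℕ → ℝ
    den d = fromℕ (suc d)

    den⁻¹ : ℕ → ℝ
    den⁻¹ d = den d ⁻¹

    den*den⁻¹ : ∀ d → den d * den⁻¹ d ≡ 1ℝ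
    den*den⁻¹ d = ⁻¹-inverse (den d) (x≢0 (0<fromℕ-suc d))

    den⁻¹-* : ∀ d e → fromℕ (suc d ℕ.* suc e) ⁻¹ ≡ den⁻¹ d * den⁻¹ e
    den⁻¹-* d e = sym (⁻¹-unique _ _ (x≢0 0<den*den) (begin
      fromℕ (suc d ℕ.* suc e) * (den⁻¹ d * den⁻¹ e) ≡⟨ cong (_* (den⁻¹ d * den⁻¹ e)) (fromℕ-* (suc d) (suc e)) ⟩
      (den d * den e) * (den⁻¹ d * den⁻¹ e)         ≡⟨ *-interchange _ _ _ _ ⟩
      (den d * den⁻¹ d) * (den e * den⁻¹ e)         ≡⟨ cong₂ _*_ (den*den⁻¹ d) (den*den⁻¹ e) ⟩
      1ℝ * 1ℝ                                       ≡⟨ *-identityˡ 1ℝ ⟩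
      1ℝ                                            ∎))
      where
      0<den*den : 0ℝ < fromℕ (suc d ℕ.* suc e)
      0<den*den = subst (0ℝ <_) (sym (fromℕ-* (suc d) (suc e))) (*-pos _ _ (0<fromℕ-suc d) (0<fromℕ-suc e))

  fromℚᵘ : ℚᵘ → ℝ
  fromℚᵘ (mkℚᵘ n d) = fromℤ n * den⁻¹ d

  fromℚᵘ-cong : ∀ p q → p ℚᵘ.≃ q → fromℚᵘ p ≡ fromℚᵘ q
  fromℚᵘ-cong (mkℚᵘ n₁ d₁) (mkℚᵘ n₂ d₂) (*≡* n₁d₂≡n₂d₁) = begin
    fromℤ n₁ * den⁻¹ d₁                            ≡⟨ sym (*-identityʳ _) ⟩
    (fromℤ n₁ * den⁻¹ d₁) * 1ℝ                     ≡⟨ cong (fromℤ n₁ * den⁻¹ d₁ *_) (sym (den*den⁻¹ d₂)) ⟩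
    (fromℤ n₁ * den⁻¹ d₁) * (den d₂ * den⁻¹ d₂)    ≡⟨ *-interchange _ _ _ _ ⟩
    (fromℤ n₁ * den d₂) * (den⁻¹ d₁ * den⁻¹ d₂)    ≡⟨ cong (_* (den⁻¹ d₁ * den⁻¹ d₂)) cross ⟩
    (fromℤ n₂ * den d₁) * (den⁻¹ d₁ * den⁻¹ d₂)
      ≡⟨ solve 4 (λ n e i j → (n :* e) :* (i :* j) := (n :* j) :* (e :* i)) refl _ _ _ _ ⟩
    (fromℤ n₂ * den⁻¹ d₂) * (den d₁ * den⁻¹ d₁)    ≡⟨ cong (fromℤ n₂ * den⁻¹ d₂ *_) (den*den⁻¹ d₁) ⟩
    (fromℤ n₂ * den⁻¹ d₂) * 1ℝ                     ≡⟨ *-identityʳ _ ⟩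
    fromℤ n₂ * den⁻¹ d₂                            ∎
    where
    cross : fromℤ n₁ * den d₂ ≡ fromℤ n₂ * den d₁
    cross = trans (sym (fromℤ-* n₁ (ℤ.+ suc d₂))) (trans (cong fromℤ n₁d₂≡n₂d₁) (fromℤ-* n₂ (ℤ.+ suc d₁)))

  fromℚᵘ-+ : ∀ p q → fromℚᵘ (p ℚᵘ.+ q) ≡ fromℚᵘ p + fromℚᵘ q
  fromℚᵘ-+ (mkℚᵘ n₁ d₁) (mkℚᵘ n₂ d₂) = begin
    fromℤ (n₁ ℤ.* ℤ.+ suc d₂ ℤ.+ n₂ ℤ.* ℤ.+ suc d₁) * fromℕ (suc d₁ ℕ.* suc d₂) ⁻¹
      ≡⟨ cong₂ _*_ (trans (fromℤ-+ (n₁ ℤ.* ℤ.+ suc d₂) (n₂ ℤ.* ℤ.+ suc d₁))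
                          (cong₂ _+_ (fromℤ-* n₁ (ℤ.+ suc d₂)) (fromℤ-* n₂ (ℤ.+ suc d₁))))
                   (den⁻¹-* d₁ d₂) ⟩
    (fromℤ n₁ * den d₂ + fromℤ n₂ * den d₁) * (den⁻¹ d₁ * den⁻¹ d₂)
      ≡⟨ solve 6 (λ n m e f i j → (n :* f :+ m :* e) :* (i :* j) := (n :* i) :* (f :* j) :+ (m :* j) :* (e :* i))
           refl (fromℤ n₁) (fromℤ n₂) (den d₁) (den d₂) (den⁻¹ d₁) (den⁻¹ d₂) ⟩
    (fromℤ n₁ * den⁻¹ d₁) * (den d₂ * den⁻¹ d₂) + (fromℤ n₂ * den⁻¹ d₂) * (den d₁ * den⁻¹ d₁)
      ≡⟨ cong₂ _+_ (trans (cong (fromℤ n₁ * den⁻¹ d₁ *_) (den*den⁻¹ d₂)) (*-identityʳ _))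
                   (trans (cong (fromℤ n₂ * den⁻¹ d₂ *_) (den*den⁻¹ d₁)) (*-identityʳ _)) ⟩
    fromℤ n₁ * den⁻¹ d₁ + fromℤ n₂ * den⁻¹ d₂
      ∎

  fromℚᵘ-* : ∀ p q → fromℚᵘ (p ℚᵘ.* q) ≡ fromℚᵘ p * fromℚᵘ q
  fromℚᵘ-* (mkℚᵘ n₁ d₁) (mkℚᵘ n₂ d₂) = begin
    fromℤ (n₁ ℤ.* n₂) * fromℕ (suc d₁ ℕ.* suc d₂) ⁻¹  ≡⟨ cong₂ _*_ (fromℤ-* n₁ n₂) (den⁻¹-* d₁ d₂) ⟩
    (fromℤ n₁ * fromℤ n₂) * (den⁻¹ d₁ * den⁻¹ d₂)     ≡⟨ *-interchange _ _ _ _ ⟩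
    (fromℤ n₁ * den⁻¹ d₁) * (fromℤ n₂ * den⁻¹ d₂)     ∎

  fromℚᵘ-neg : ∀ p → fromℚᵘ (ℚᵘ.- p) ≡ - fromℚᵘ p
  fromℚᵘ-neg (mkℚᵘ n d) = trans (cong (_* den⁻¹ d) (fromℤ-neg n)) (sym (-‿distribˡ-* _ _))

  fromℚ≃fromℚᵘ : ∀ q {u} → ℚ.toℚᵘ q ℚᵘ.≃ u → fromℚ q ≡ fromℚᵘ u
  fromℚ≃fromℚᵘ (mkℚ n d _) = fromℚᵘ-cong (mkℚᵘ n d) _

  fromℚ-+ : ∀ p q → fromℚ (p ℚ.+ q) ≡ fromℚ p + fromℚ q
  fromℚ-+ p@record{} q@record{} =
    trans (fromℚ≃fromℚᵘ (p ℚ.+ q) (ℚ.toℚᵘ-homo-+ p q)) (fromℚᵘ-+ (ℚ.toℚᵘ p) (ℚ.toℚᵘ q))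

  fromℚ-* : ∀ p q → fromℚ (p ℚ.* q) ≡ fromℚ p * fromℚ q
  fromℚ-* p@record{} q@record{} =
    trans (fromℚ≃fromℚᵘ (p ℚ.* q) (ℚ.toℚᵘ-homo-* p q)) (fromℚᵘ-* (ℚ.toℚᵘ p) (ℚ.toℚᵘ q))

  fromℚ-neg : ∀ p → fromℚ (ℚ.- p) ≡ - fromℚ p
  fromℚ-neg p@record{} = trans (fromℚ≃fromℚᵘ (ℚ.- p) (ℚ.toℚᵘ-homo‿- p)) (fromℚᵘ-neg (ℚ.toℚᵘ p))

  fromℚ-0 : fromℚ 0ℚ ≡ 0ℝ
  fromℚ-0 = zeroˡ _

  fromℚ-1 : fromℚ 1ℚ ≡ 1ℝ
  fromℚ-1 = den*den⁻¹ 0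

  fromℚ-1/-inverse : ∀ a .{{_ : ℚ.NonZero a}} → fromℚ (ℚ.1/ a) * fromℚ a ≡ 1ℝ
  fromℚ-1/-inverse a = trans (sym (fromℚ-* (ℚ.1/ a) a)) (trans (cong fromℚ (ℚ.*-inverseˡ a)) fromℚ-1)

  0<fromℚ : ∀ q → {{ℚ.Positive q}} → 0ℝ < fromℚ q
  0<fromℚ (mkℚ +[1+ k ] d _) = *-pos _ _ (0<fromℕ-suc k) (⁻¹-pos (0<fromℕ-suc d))

  fromℚ<0 : ∀ q → {{ℚ.Negative q}} → fromℚ q < 0ℝ
  fromℚ<0 q@(mkℚ -[1+ k ] d _) =
    subst₂ _<_ (-‿distribˡ-* _ _) -0#≈0# (neg-antimono-< (0<fromℚ (ℚ.- q)))

  half : ℝ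
  half = fromℚ ½

  half+half : half + half ≡ 1ℝ
  half+half = trans (sym (fromℚ-+ ½ ½)) fromℚ-1

  midpoint-between : ∀ {x y} → x < y → x < half * (x + y) × half * (x + y) < y
  midpoint-between {x} {y} x<y =
    subst (_< half * (x + y)) (halves x) (*-monoʳ-<-pos 0<half (+-monoʳ-< x x<y)) ,
    subst (half * (x + y) <_) (halves y) (*-monoʳ-<-pos 0<half (+-monoˡ-< y x<y))
    where
    0<half : 0ℝ < half
    0<half = 0<fromℚ ½
    halves : ∀ z → half * (z + z) ≡ z
    halves z = trans (solve 2 (λ h z → h :* (z :+ z) := z :* (h :+ h)) refl half z)
                     (trans (cong (z *_) half+half) (*-identityʳ z))

infixl 6 _+ᵉ_ _-ᵉ_
infixr 7 _·ᵉ_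

constᵉ : ℚ → LinExp m
constᵉ q = linexp (λ _ → 0ℚ) q

0ᵉ : LinExp m
0ᵉ = constᵉ 0ℚ

_+ᵉ_ : LinExp m → LinExp m → LinExp m
linexp c q +ᵉ linexp c′ q′ = linexp (λ i → c i ℚ.+ c′ i) (q ℚ.+ q′)

_·ᵉ_ : ℚ → LinExp m → LinExp m
r ·ᵉ linexp c q = linexp (λ i → r ℚ.* c i) (r ℚ.* q)

_-ᵉ_ : LinExp m → LinExp m → LinExp m
e -ᵉ e′ = e +ᵉ (ℚ.- 1ℚ) ·ᵉ e′

lead : LinExp (suc m) → ℚ
lead (linexp c q) = c zero

rest : LinExp (suc m) → LinExp m
rest (linexp c q) = linexp (c ∘ suc) q

weaken : LinExp m → LinExp (suc m)
weaken (linexp c q) = linexp (0ℚ Vector.∷ c) q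

var : Fin m → LinExp m
var zero    = linexp (1ℚ Vector.∷ λ _ → 0ℚ) 0ℚ
var (suc i) = weaken (var i)

_[_]ᵉ : LinExp (suc m) → LinExp m → LinExp m
e [ t ]ᵉ = lead e ·ᵉ t +ᵉ rest e

solveFor : ℚ → LinExp m → List (LinExp m)
solveFor (mkℚ (ℤ.+ 0) _ _)      s = []
solveFor a@(mkℚ +[1+ _ ] _ _) s = (ℚ.- ℚ.1/ a) ·ᵉ s ∷ []
solveFor a@(mkℚ -[1+ _ ] _ _) s = (ℚ.- ℚ.1/ a) ·ᵉ s ∷ []

root : LinExp (suc m) → List (LinExp m)
root e = solveFor (lead e) (rest e)

mapIneq : (LinExp m → LinExp n) → Ineq m → Ineq n
mapIneq g (a <ᵉ b) = g a <ᵉ g b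
mapIneq g (a ≤ᵉ b) = g a ≤ᵉ g b

negateIneq : Ineq m → Ineq m
negateIneq (a <ᵉ b) = b ≤ᵉ a
negateIneq (a ≤ᵉ b) = b <ᵉ a

atomRoot : Ineq (suc m) → List (LinExp m)
atomRoot (a <ᵉ b) = root (b -ᵉ a)
atomRoot (a ≤ᵉ b) = root (b -ᵉ a)

infixr 6 _∧_
infixr 5 _∨_

data QF (m : ℕ) : Set where
  atom : Ineq m → QF m
  _∧_  : QF m → QF m → QF m
  _∨_  : QF m → QF m → QF m

⊤q ⊥q : QF m
⊤q = atom (0ᵉ ≤ᵉ 0ᵉ)
⊥q = atom (0ᵉ <ᵉ 0ᵉ)

⋀ ⋁ : List (QF m) → QF m
⋀ = foldr _∧_ ⊤q
⋁ = foldr _∨_ ⊥q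

negate : QF m → QF m
negate (atom α) = atom (negateIneq α)
negate (ψ ∧ χ)  = negate ψ ∨ negate χ
negate (ψ ∨ χ)  = negate ψ ∧ negate χ

_[_] : QF (suc m) → LinExp m → QF m
atom α  [ t ] = atom (mapIneq _[ t ]ᵉ α)
(ψ ∧ χ) [ t ] = ψ [ t ] ∧ χ [ t ]
(ψ ∨ χ) [ t ] = ψ [ t ] ∨ χ [ t ]

roots : QF (suc m) → List (LinExp m)
roots (atom α) = atomRoot α
roots (ψ ∧ χ)  = roots ψ ++ roots χ
roots (ψ ∨ χ)  = roots ψ ++ roots χ

⌜_⌝ : QF m → Formula m
⌜ atom α ⌝ = atom α
⌜ ψ ∧ χ ⌝  = ⌜ ψ ⌝ ∧ᶠ ⌜ χ ⌝
⌜ ψ ∨ χ ⌝  = ⌜ ψ ⌝ ∨ᶠ ⌜ χ ⌝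

dnf : QF m → List (List (Ineq m))
dnf (atom α) = (α ∷ []) ∷ []
dnf (ψ ∧ χ)  = cartesianProductWith _++_ (dnf ψ) (dnf χ)
dnf (ψ ∨ χ)  = dnf ψ ++ dnf χ

-- Ferrante–Rackoff quantifier elimination

succᵉ predᵉ : LinExp m → LinExp m
succᵉ t = t +ᵉ constᵉ 1ℚ
predᵉ t = t +ᵉ constᵉ (ℚ.- 1ℚ)

midpoint : LinExp m → LinExp m → LinExp m
midpoint t u = ½ ·ᵉ (t +ᵉ u)

testPoints : List (LinExp m) → List (LinExp m)
testPoints ts = 0ᵉ ∷ ts ++ map succᵉ ts ++ map predᵉ ts ++ cartesianProductWith midpoint ts ts

module _ {ts : List (LinExp m)} {t : LinExp m} (t∈ts : t ∈ ts) where

  term∈testPoints : t ∈ testPoints ts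
  term∈testPoints = there (∈-++⁺ˡ t∈ts)

  succ∈testPoints : succᵉ t ∈ testPoints ts
  succ∈testPoints = there (∈-++⁺ʳ ts (∈-++⁺ˡ (∈-map⁺ succᵉ t∈ts)))

  pred∈testPoints : predᵉ t ∈ testPoints ts
  pred∈testPoints = there (∈-++⁺ʳ ts (∈-++⁺ʳ (map succᵉ ts) (∈-++⁺ˡ (∈-map⁺ predᵉ t∈ts))))

  midpoint∈testPoints : ∀ {u} → u ∈ ts → midpoint t u ∈ testPoints ts
  midpoint∈testPoints u∈ts = there (∈-++⁺ʳ ts (∈-++⁺ʳ (map succᵉ ts) (∈-++⁺ʳ (map predᵉ ts)
    (∈-cartesianProductWith⁺ midpoint t∈ts u∈ts))))

eliminate : QF (suc m) → QF m
eliminate ψ = ⋁ (map (ψ [_]) (testPoints (roots ψ)))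

qe : Formula m → QF m
qe (atom α) = atom α
qe (¬ᶠ φ)   = negate (qe φ)
qe (φ ∧ᶠ ψ) = qe φ ∧ qe ψ
qe (φ ∨ᶠ ψ) = qe φ ∨ qe ψ
qe (∃ᶠ φ)   = eliminate (qe φ)
qe (∀ᶠ φ)   = negate (eliminate (negate (qe φ)))

inUnit : LinExp m → QF m
inUnit e = atom (0ᵉ ≤ᵉ e) ∧ atom (e ≤ᵉ constᵉ 1ℚ)

branch : CondExp n → QF (suc n)
branch (C ⊢ e) = ⋀ (map (atom ∘ mapIneq weaken) C) ∧ atom (var zero ≤ᵉ weaken e) ∧ atom (weaken e ≤ᵉ var zero)

graphQF : System n → QF (suc n)
graphQF 𝓕 = ⋀ (tabulate (inUnit ∘ var ∘ suc)) ∧ inUnit (var zero) ∧ ⋁ (map branch 𝓕)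

graphFormula : System n → Formula (suc n)
graphFormula 𝓕 = ⌜ graphQF 𝓕 ⌝

branchesAt : QF (suc n) → List (LinExp n) → System n
branchesAt ψ = concatMap (λ t → map (_⊢ t) (dnf (ψ [ t ])))

representingSystem : Formula (suc n) → System n
representingSystem F = branchesAt (qe F) (testPoints (roots (qe F)))

module Evaluation (R : Reals) where

  open Reals R
  open Semantics R
  open RealArithmetic R
  open CommutativeRing commutativeRing using (semiring)
  open import Algebra.Properties.Semiring.Sum semiring
    using (sum; sum-cong-≗; sum-replicate-zero; ∑-distrib-+; *-distribˡ-sum)
  open ≡-Reasoning

  sumℝ≡sum : ∀ {n} (v : Fin n → ℝ) → sumℝ v ≡ sum v
  sumℝ≡sum {zero}  v = refl
  sumℝ≡sum {suc n} v = cong (v zero +_) (sumℝ≡sum (v ∘ suc))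

  dot : (Fin m → ℚ) → (Fin m → ℝ) → ℝ
  dot c ρ = sum (λ i → fromℚ (c i) * ρ i)

  evalE≡dot : ∀ (c : Fin m → ℚ) q ρ → evalE (linexp c q) ρ ≡ dot c ρ + fromℚ q
  evalE≡dot c q ρ = cong (_+ fromℚ q) (sumℝ≡sum (λ i → fromℚ (c i) * ρ i))

  dot-+ : ∀ (c c′ : Fin m → ℚ) ρ → dot (λ i → c i ℚ.+ c′ i) ρ ≡ dot c ρ + dot c′ ρ
  dot-+ c c′ ρ = trans (sum-cong-≗ (λ i → trans (cong (_* ρ i) (fromℚ-+ (c i) (c′ i))) (distribʳ _ _ _)))
                       (∑-distrib-+ (λ i → fromℚ (c i) * ρ i) (λ i → fromℚ (c′ i) * ρ i))

  dot-* : ∀ r (c : Fin m → ℚ) ρ → dot (λ i → r ℚ.* c i) ρ ≡ fromℚ r * dot c ρ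
  dot-* r c ρ = trans (sum-cong-≗ (λ i → trans (cong (_* ρ i) (fromℚ-* r (c i))) (*-assoc _ _ _)))
                      (sym (*-distribˡ-sum (fromℚ r) (λ i → fromℚ (c i) * ρ i)))

  dot-0 : ∀ (ρ : Fin m → ℝ) → dot (λ _ → 0ℚ) ρ ≡ 0ℝ
  dot-0 {m} ρ = trans (sum-cong-≗ (λ i → trans (cong (_* ρ i) fromℚ-0) (zeroˡ (ρ i)))) (sum-replicate-zero m)

  evalE-+ᵉ : ∀ (e e′ : LinExp m) ρ → evalE (e +ᵉ e′) ρ ≡ evalE e ρ + evalE e′ ρ
  evalE-+ᵉ (linexp c q) (linexp c′ q′) ρ = begin
    evalE (linexp (λ i → c i ℚ.+ c′ i) (q ℚ.+ q′)) ρ   ≡⟨ evalE≡dot (λ i → c i ℚ.+ c′ i) (q ℚ.+ q′) ρ ⟩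
    dot (λ i → c i ℚ.+ c′ i) ρ + fromℚ (q ℚ.+ q′)      ≡⟨ cong₂ _+_ (dot-+ c c′ ρ) (fromℚ-+ q q′) ⟩
    (dot c ρ + dot c′ ρ) + (fromℚ q + fromℚ q′)        ≡⟨ +-interchange _ _ _ _ ⟩
    (dot c ρ + fromℚ q) + (dot c′ ρ + fromℚ q′)        ≡⟨ sym (cong₂ _+_ (evalE≡dot c q ρ) (evalE≡dot c′ q′ ρ)) ⟩
    evalE (linexp c q) ρ + evalE (linexp c′ q′) ρ      ∎

  evalE-·ᵉ : ∀ r (e : LinExp m) ρ → evalE (r ·ᵉ e) ρ ≡ fromℚ r * evalE e ρ
  evalE-·ᵉ r (linexp c q) ρ = begin
    evalE (linexp (λ i → r ℚ.* c i) (r ℚ.* q)) ρ   ≡⟨ evalE≡dot (λ i → r ℚ.* c i) (r ℚ.* q) ρ ⟩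
    dot (λ i → r ℚ.* c i) ρ + fromℚ (r ℚ.* q)      ≡⟨ cong₂ _+_ (dot-* r c ρ) (fromℚ-* r q) ⟩
    fromℚ r * dot c ρ + fromℚ r * fromℚ q          ≡⟨ sym (distribˡ _ _ _) ⟩
    fromℚ r * (dot c ρ + fromℚ q)                  ≡⟨ cong (fromℚ r *_) (sym (evalE≡dot c q ρ)) ⟩
    fromℚ r * evalE (linexp c q) ρ                 ∎

  evalE-constᵉ : ∀ q (ρ : Fin m → ℝ) → evalE (constᵉ q) ρ ≡ fromℚ q
  evalE-constᵉ q ρ = trans (evalE≡dot (λ _ → 0ℚ) q ρ) (trans (cong (_+ fromℚ q) (dot-0 ρ)) (+-identityˡ _))

  evalE-0ᵉ : ∀ (ρ : Fin m → ℝ) → evalE 0ᵉ ρ ≡ 0ℝ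
  evalE-0ᵉ ρ = trans (evalE-constᵉ 0ℚ ρ) fromℚ-0

  evalE-lead-rest : ∀ (e : LinExp (suc m)) ρ → evalE e ρ ≡ fromℚ (lead e) * ρ zero + evalE (rest e) (ρ ∘ suc)
  evalE-lead-rest e ρ = +-assoc _ _ _

  evalE-weaken : ∀ (e : LinExp m) ρ → evalE (weaken e) ρ ≡ evalE e (ρ ∘ suc)
  evalE-weaken e ρ = begin
    evalE (weaken e) ρ                      ≡⟨ evalE-lead-rest (weaken e) ρ ⟩
    fromℚ 0ℚ * ρ zero + evalE e (ρ ∘ suc)
      ≡⟨ cong (_+ evalE e (ρ ∘ suc)) (trans (cong (_* ρ zero) fromℚ-0) (zeroˡ _)) ⟩
    0ℝ + evalE e (ρ ∘ suc)                  ≡⟨ +-identityˡ _ ⟩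
    evalE e (ρ ∘ suc)                       ∎

  evalE-var : ∀ (i : Fin m) ρ → evalE (var i) ρ ≡ ρ i
  evalE-var zero ρ = begin
    evalE (var zero) ρ                          ≡⟨ evalE-lead-rest (var zero) ρ ⟩
    fromℚ 1ℚ * ρ zero + evalE 0ᵉ (ρ ∘ suc)
      ≡⟨ cong₂ _+_ (trans (cong (_* ρ zero) fromℚ-1) (*-identityˡ _)) (evalE-0ᵉ (ρ ∘ suc)) ⟩
    ρ zero + 0ℝ                                 ≡⟨ +-identityʳ _ ⟩
    ρ zero                                      ∎
  evalE-var (suc i) ρ = trans (evalE-weaken (var i) ρ) (evalE-var i (ρ ∘ suc))

  evalE-subst : ∀ (e : LinExp (suc m)) t x → evalE (e [ t ]ᵉ) x ≡ evalE e (evalE t x ∷ᵛ x)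
  evalE-subst e t x = begin
    evalE (lead e ·ᵉ t +ᵉ rest e) x               ≡⟨ evalE-+ᵉ (lead e ·ᵉ t) (rest e) x ⟩
    evalE (lead e ·ᵉ t) x + evalE (rest e) x      ≡⟨ cong (_+ evalE (rest e) x) (evalE-·ᵉ (lead e) t x) ⟩
    fromℚ (lead e) * evalE t x + evalE (rest e) x ≡⟨ sym (evalE-lead-rest e (evalE t x ∷ᵛ x)) ⟩
    evalE e (evalE t x ∷ᵛ x)                      ∎

  evalE-succᵉ : ∀ (t : LinExp m) ρ → evalE (succᵉ t) ρ ≡ evalE t ρ + 1ℝ
  evalE-succᵉ t ρ = trans (evalE-+ᵉ t (constᵉ 1ℚ) ρ) (cong (evalE t ρ +_) (trans (evalE-constᵉ 1ℚ ρ) fromℚ-1))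

  evalE-predᵉ : ∀ (t : LinExp m) ρ → evalE (predᵉ t) ρ ≡ evalE t ρ + - 1ℝ
  evalE-predᵉ t ρ = trans (evalE-+ᵉ t (constᵉ (ℚ.- 1ℚ)) ρ)
    (cong (evalE t ρ +_) (trans (evalE-constᵉ (ℚ.- 1ℚ) ρ) (trans (fromℚ-neg 1ℚ) (cong -_ fromℚ-1))))

  evalE-midpoint : ∀ (t u : LinExp m) ρ → evalE (midpoint t u) ρ ≡ half * (evalE t ρ + evalE u ρ)
  evalE-midpoint t u ρ = trans (evalE-·ᵉ ½ (t +ᵉ u) ρ) (cong (half *_) (evalE-+ᵉ t u ρ))

  evalE--ᵉ : ∀ (e e′ : LinExp m) ρ → evalE (e -ᵉ e′) ρ ≡ evalE e ρ + - evalE e′ ρ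
  evalE--ᵉ e e′ ρ = trans (evalE-+ᵉ e ((ℚ.- 1ℚ) ·ᵉ e′) ρ) (cong (evalE e ρ +_) (begin
    evalE ((ℚ.- 1ℚ) ·ᵉ e′) ρ        ≡⟨ evalE-·ᵉ (ℚ.- 1ℚ) e′ ρ ⟩
    fromℚ (ℚ.- 1ℚ) * evalE e′ ρ     ≡⟨ cong (_* evalE e′ ρ) (trans (fromℚ-neg 1ℚ) (cong -_ fromℚ-1)) ⟩
    - 1ℝ * evalE e′ ρ               ≡⟨ -1*x≈-x _ ⟩
    - evalE e′ ρ                    ∎))

-- Correctness of quantifier elimination

module QuantifierElimination (R : Reals) where

  open Reals R
  open Semantics R
  open RealArithmetic R
  open Evaluation R
  open ≡-Reasoning

  ⟦_⟧q : QF m → (Fin m → ℝ) → Set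
  ⟦ atom α ⟧q ρ = evalI α ρ
  ⟦ ψ ∧ χ ⟧q ρ  = ⟦ ψ ⟧q ρ × ⟦ χ ⟧q ρ
  ⟦ ψ ∨ χ ⟧q ρ  = ⟦ ψ ⟧q ρ ⊎ ⟦ χ ⟧q ρ

  ⟦⌜_⌝⟧ : ∀ (ψ : QF m) ρ → ⟦ ⌜ ψ ⌝ ⟧ ρ ≡ ⟦ ψ ⟧q ρ
  ⟦⌜ atom α ⌝⟧ ρ = refl
  ⟦⌜ ψ ∧ χ ⌝⟧ ρ  = cong₂ _×_ (⟦⌜ ψ ⌝⟧ ρ) (⟦⌜ χ ⌝⟧ ρ)
  ⟦⌜ ψ ∨ χ ⌝⟧ ρ  = cong₂ _⊎_ (⟦⌜ ψ ⌝⟧ ρ) (⟦⌜ χ ⌝⟧ ρ)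

  ⟦⋀⟧ : ∀ (ψs : List (QF m)) ρ → ⟦ ⋀ ψs ⟧q ρ ⇔ All (λ ψ → ⟦ ψ ⟧q ρ) ψs
  ⟦⋀⟧ []       ρ = mk⇔ (λ _ → []) (λ _ → inj₂ refl)
  ⟦⋀⟧ (ψ ∷ ψs) ρ = mk⇔ (λ (p , ps) → p ∷ to (⟦⋀⟧ ψs ρ) ps) (λ { (p ∷ ps) → p , from (⟦⋀⟧ ψs ρ) ps })

  ⟦⋁⟧ : ∀ (ψs : List (QF m)) ρ → ⟦ ⋁ ψs ⟧q ρ ⇔ Any (λ ψ → ⟦ ψ ⟧q ρ) ψs
  ⟦⋁⟧ []       ρ = mk⇔ (λ 0<0 → ⊥-elim (irrefl refl 0<0)) (λ ())
  ⟦⋁⟧ (ψ ∷ ψs) ρ = mk⇔ [ here , there ∘ to (⟦⋁⟧ ψs ρ) ]′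
                       (λ { (here p) → inj₁ p ; (there ps) → inj₂ (from (⟦⋁⟧ ψs ρ) ps) })

  decide : ∀ (ψ : QF m) ρ → Dec (⟦ ψ ⟧q ρ)
  decide (atom (a <ᵉ b)) ρ = evalE a ρ <? evalE b ρ
  decide (atom (a ≤ᵉ b)) ρ = (evalE a ρ <? evalE b ρ) ⊎-dec (evalE a ρ ≟ evalE b ρ)
  decide (ψ ∧ χ) ρ         = decide ψ ρ ×-dec decide χ ρ
  decide (ψ ∨ χ) ρ         = decide ψ ρ ⊎-dec decide χ ρ

  negate-sound : ∀ (ψ : QF m) ρ → ⟦ negate ψ ⟧q ρ → ¬ ⟦ ψ ⟧q ρ
  negate-sound (atom (a <ᵉ b)) ρ b≤a       = ≤⇒≯ b≤a
  negate-sound (atom (a ≤ᵉ b)) ρ b<a       = <⇒≱ b<a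
  negate-sound (ψ ∧ χ) ρ (inj₁ ¬ψ) (p , _) = negate-sound ψ ρ ¬ψ p
  negate-sound (ψ ∧ χ) ρ (inj₂ ¬χ) (_ , q) = negate-sound χ ρ ¬χ q
  negate-sound (ψ ∨ χ) ρ (¬ψ , ¬χ)         = [ negate-sound ψ ρ ¬ψ , negate-sound χ ρ ¬χ ]′

  negate-complete : ∀ (ψ : QF m) ρ → ¬ ⟦ ψ ⟧q ρ → ⟦ negate ψ ⟧q ρ
  negate-complete (atom (a <ᵉ b)) ρ a≮b = ≮⇒≥ a≮b
  negate-complete (atom (a ≤ᵉ b)) ρ a≰b = ≰⇒> a≰b
  negate-complete (ψ ∧ χ) ρ ¬ψχ with decide ψ ρ
  ... | yes p = inj₂ (negate-complete χ ρ (λ q → ¬ψχ (p , q)))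
  ... | no ¬p = inj₁ (negate-complete ψ ρ ¬p)
  negate-complete (ψ ∨ χ) ρ ¬ψχ = negate-complete ψ ρ (¬ψχ ∘ inj₁) , negate-complete χ ρ (¬ψχ ∘ inj₂)

  evalI-mapIneq : ∀ (g : LinExp m → LinExp n) α ρ ρ′ → (∀ e → evalE (g e) ρ ≡ evalE e ρ′) →
                  evalI (mapIneq g α) ρ ≡ evalI α ρ′
  evalI-mapIneq g (a <ᵉ b) ρ ρ′ eval-g = cong₂ _<_ (eval-g a) (eval-g b)
  evalI-mapIneq g (a ≤ᵉ b) ρ ρ′ eval-g = cong₂ _≤_ (eval-g a) (eval-g b)

  ⟦_[_]⟧ : ∀ (ψ : QF (suc m)) t x → ⟦ ψ [ t ] ⟧q x ≡ ⟦ ψ ⟧q (evalE t x ∷ᵛ x)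
  ⟦ atom α [ t ]⟧ x = evalI-mapIneq _[ t ]ᵉ α x _ (λ e → evalE-subst e t x)
  ⟦ ψ ∧ χ [ t ]⟧ x  = cong₂ _×_ (⟦ ψ [ t ]⟧ x) (⟦ χ [ t ]⟧ x)
  ⟦ ψ ∨ χ [ t ]⟧ x  = cong₂ _⊎_ (⟦ ψ [ t ]⟧ x) (⟦ χ [ t ]⟧ x)

  ⟦dnf⟧ : ∀ (ψ : QF m) ρ → ⟦ ψ ⟧q ρ ⇔ Any (λ D → HoldsC D ρ) (dnf ψ)
  ⟦dnf⟧ (atom α) ρ = mk⇔ (λ p → here (p ∷ [])) (λ { (here (p ∷ [])) → p })
  ⟦dnf⟧ (ψ ∧ χ) ρ = mk⇔
    (λ (p , q) → cartesianProductWith⁺ _++_ All.++⁺ (to (⟦dnf⟧ ψ ρ) p) (to (⟦dnf⟧ χ ρ) q))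
    (Product.map (from (⟦dnf⟧ ψ ρ)) (from (⟦dnf⟧ χ ρ))
      ∘ cartesianProductWith⁻ _++_ (λ {D} h → All.++⁻ˡ D h , All.++⁻ʳ D h) (dnf ψ) (dnf χ))
  ⟦dnf⟧ (ψ ∨ χ) ρ = mk⇔
    [ ++⁺ˡ ∘ to (⟦dnf⟧ ψ ρ) , ++⁺ʳ (dnf ψ) ∘ to (⟦dnf⟧ χ ρ) ]′
    (Sum.map (from (⟦dnf⟧ ψ ρ)) (from (⟦dnf⟧ χ ρ)) ∘ ++⁻ (dnf ψ))

  SameCell : List (LinExp m) → (Fin m → ℝ) → ℝ → ℝ → Set
  SameCell ts x y z = All (λ t → cmp (evalE t x) y ≡ cmp (evalE t x) z) ts

  cmp-difference : ∀ u v → cmp u v ≡ cmp 0ℝ (v + - u)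
  cmp-difference u v = begin
    cmp u v                      ≡⟨ sym (cmp-monotone (+-monoˡ-< (- u)) u v) ⟩
    cmp (u + - u) (v + - u)      ≡⟨ cong (λ w → cmp w (v + - u)) (-‿inverseʳ u) ⟩
    cmp 0ℝ (v + - u)             ∎

  cmp-affine-pos : ∀ {a s T} → 0ℝ < a → a * T + s ≡ 0ℝ → ∀ y → cmp 0ℝ (a * y + s) ≡ cmp T y
  cmp-affine-pos {a} {s} {T} 0<a root y = begin
    cmp 0ℝ (a * y + s)           ≡⟨ cong (λ w → cmp w (a * y + s)) (sym root) ⟩
    cmp (a * T + s) (a * y + s)  ≡⟨ cmp-monotone (+-monoˡ-< s ∘ *-monoʳ-<-pos 0<a) T y ⟩
    cmp T y                      ∎

  cmp-affine-neg : ∀ {a s T} → a < 0ℝ → a * T + s ≡ 0ℝ → ∀ y → cmp 0ℝ (a * y + s) ≡ reverse (cmp T y)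
  cmp-affine-neg {a} {s} {T} a<0 root y = begin
    cmp 0ℝ (a * y + s)           ≡⟨ cong (λ w → cmp w (a * y + s)) (sym root) ⟩
    cmp (a * T + s) (a * y + s)  ≡⟨ cmp-antitone (+-monoˡ-< s ∘ *-monoʳ-<-neg a<0) T y ⟩
    reverse (cmp T y)            ∎

  solveFor-root : ∀ a .{{_ : ℚ.NonZero a}} (s : LinExp m) x →
                  fromℚ a * evalE ((ℚ.- ℚ.1/ a) ·ᵉ s) x + evalE s x ≡ 0ℝ
  solveFor-root a s x = begin
    A * evalE ((ℚ.- ℚ.1/ a) ·ᵉ s) x + S
      ≡⟨ cong (λ w → A * w + S) (trans (evalE-·ᵉ (ℚ.- ℚ.1/ a) s x) (cong (_* S) (fromℚ-neg (ℚ.1/ a)))) ⟩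
    A * (- A⁻¹ * S) + S
      ≡⟨ solve 3 (λ A I S → A :* (:- I :* S) :+ S := S :- (I :* A) :* S) refl A A⁻¹ S ⟩
    S + - ((A⁻¹ * A) * S)                 ≡⟨ cong (λ w → S + - (w * S)) (fromℚ-1/-inverse a) ⟩
    S + - (1ℝ * S)                        ≡⟨ cong (λ w → S + - w) (*-identityˡ S) ⟩
    S + - S                               ≡⟨ -‿inverseʳ S ⟩
    0ℝ                                    ∎
    where
    A = fromℚ a
    A⁻¹ = fromℚ (ℚ.1/ a)
    S = evalE s x

  cmp-solveFor : ∀ a (s : LinExp m) x {y z} → SameCell (solveFor a s) x y z →
                 cmp 0ℝ (fromℚ a * y + evalE s x) ≡ cmp 0ℝ (fromℚ a * z + evalE s x)
  cmp-solveFor a@(mkℚ (ℤ.+ 0) _ _) s x {y} {z} [] =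
    cong (λ w → cmp 0ℝ (w + evalE s x)) (trans (vanishes y) (sym (vanishes z)))
    where
    vanishes : ∀ w → fromℚ a * w ≡ 0ℝ
    vanishes w = trans (cong (_* w) (zeroˡ _)) (zeroˡ w)
  cmp-solveFor a@(mkℚ +[1+ _ ] _ _) s x {y} {z} (same ∷ []) = begin
    cmp 0ℝ (fromℚ a * y + evalE s x)   ≡⟨ cmp-affine-pos (0<fromℚ a) (solveFor-root a s x) y ⟩
    cmp _ y                            ≡⟨ same ⟩
    cmp _ z                            ≡⟨ sym (cmp-affine-pos (0<fromℚ a) (solveFor-root a s x) z) ⟩
    cmp 0ℝ (fromℚ a * z + evalE s x)   ∎
  cmp-solveFor a@(mkℚ -[1+ _ ] _ _) s x {y} {z} (same ∷ []) = begin
    cmp 0ℝ (fromℚ a * y + evalE s x)   ≡⟨ cmp-affine-neg (fromℚ<0 a) (solveFor-root a s x) y ⟩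
    reverse (cmp _ y)                  ≡⟨ cong reverse same ⟩
    reverse (cmp _ z)                  ≡⟨ sym (cmp-affine-neg (fromℚ<0 a) (solveFor-root a s x) z) ⟩
    cmp 0ℝ (fromℚ a * z + evalE s x)   ∎

  cmp-atom : ∀ (a b : LinExp (suc m)) x {y z} → SameCell (root (b -ᵉ a)) x y z →
             cmp (evalE a (y ∷ᵛ x)) (evalE b (y ∷ᵛ x)) ≡ cmp (evalE a (z ∷ᵛ x)) (evalE b (z ∷ᵛ x))
  cmp-atom a b x {y} {z} same =
    trans (as-affine y) (trans (cmp-solveFor (lead (b -ᵉ a)) (rest (b -ᵉ a)) x same) (sym (as-affine z)))
    where
    as-affine : ∀ w → cmp (evalE a (w ∷ᵛ x)) (evalE b (w ∷ᵛ x))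
                    ≡ cmp 0ℝ (fromℚ (lead (b -ᵉ a)) * w + evalE (rest (b -ᵉ a)) x)
    as-affine w = trans (cmp-difference _ _)
      (cong (cmp 0ℝ) (trans (sym (evalE--ᵉ b a (w ∷ᵛ x))) (evalE-lead-rest (b -ᵉ a) (w ∷ᵛ x))))

  ⟦⟧q-resp-SameCell : ∀ (ψ : QF (suc m)) x {y z} → SameCell (roots ψ) x y z →
                      ⟦ ψ ⟧q (y ∷ᵛ x) → ⟦ ψ ⟧q (z ∷ᵛ x)
  ⟦⟧q-resp-SameCell (atom (a <ᵉ b)) x same = cmp-resp-< (cmp-atom a b x same)
  ⟦⟧q-resp-SameCell (atom (a ≤ᵉ b)) x same = cmp-resp-≤ (cmp-atom a b x same)
  ⟦⟧q-resp-SameCell (ψ ∧ χ) x same =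
    Product.map (⟦⟧q-resp-SameCell ψ x (All.++⁻ˡ (roots ψ) same)) (⟦⟧q-resp-SameCell χ x (All.++⁻ʳ (roots ψ) same))
  ⟦⟧q-resp-SameCell (ψ ∨ χ) x same =
    Sum.map (⟦⟧q-resp-SameCell ψ x (All.++⁻ˡ (roots ψ) same)) (⟦⟧q-resp-SameCell χ x (All.++⁻ʳ (roots ψ) same))

  module _ (x : Fin m → ℝ) where

    private
      val : LinExp m → ℝ
      val t = evalE t x

    sameCell-avoiding : ∀ ts {y z} → All (λ u → val u ≢ y) ts →
      (∀ {u} → u ∈ ts → val u < y → val u < z) → (∀ {u} → u ∈ ts → y < val u → z < val u) → SameCell ts x y z
    sameCell-avoiding ts ≢y below above = All.tabulate λ u∈ → sameSide (All.lookup ≢y u∈) (below u∈) (above u∈)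

    testPoint-sameCell : ∀ ts y → Any (λ t → SameCell ts x y (val t)) (testPoints ts)
    testPoint-sameCell ts y with any? (λ t → val t ≟ y) ts | greatestBelow val y ts | leastAbove val y ts
    ... | yes hit | _ | _ = let t , t∈ , t≡y = find hit in
      lose (term∈testPoints t∈) (All.universal (λ u → cong (cmp (val u)) (sym t≡y)) ts)
    ... | no miss | inj₂ (l , l∈ , l<y , max) | inj₂ (k , k∈ , y<k , min) =
      lose (midpoint∈testPoints l∈ k∈) (sameCell-avoiding ts (All.¬Any⇒All¬ ts miss)
        (λ u∈ u<y → ≤-<-trans (All.lookup max u∈ u<y) (subst (val l <_) (sym (evalE-midpoint l k x)) l<mid))
        (λ u∈ y<u → <-≤-trans (subst (_< val k) (sym (evalE-midpoint l k x)) mid<k) (All.lookup min u∈ y<u)))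
      where
      l<mid : val l < half * (val l + val k)
      l<mid = proj₁ (midpoint-between (<-trans l<y y<k))
      mid<k : half * (val l + val k) < val k
      mid<k = proj₂ (midpoint-between (<-trans l<y y<k))
    ... | no miss | inj₂ (l , l∈ , l<y , max) | inj₁ nothing-above =
      lose (succ∈testPoints l∈) (sameCell-avoiding ts (All.¬Any⇒All¬ ts miss)
        (λ u∈ u<y → ≤-<-trans (All.lookup max u∈ u<y) (subst (val l <_) (sym (evalE-succᵉ l x)) (x<x+1 (val l))))
        (λ u∈ → ⊥-elim ∘ All.lookup nothing-above u∈))
    ... | no miss | inj₁ nothing-below | inj₂ (k , k∈ , y<k , min) =
      lose (pred∈testPoints k∈) (sameCell-avoiding ts (All.¬Any⇒All¬ ts miss)
        (λ u∈ → ⊥-elim ∘ All.lookup nothing-below u∈)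
        (λ u∈ y<u → <-≤-trans (subst (_< val k) (sym (evalE-predᵉ k x)) (x-1<x (val k))) (All.lookup min u∈ y<u)))
    ... | no miss | inj₁ nothing-below | inj₁ nothing-above =
      here (sameCell-avoiding ts (All.¬Any⇒All¬ ts miss)
        (λ u∈ → ⊥-elim ∘ All.lookup nothing-below u∈) (λ u∈ → ⊥-elim ∘ All.lookup nothing-above u∈))

  testPoint-witness : ∀ (ψ : QF (suc m)) x {y} → ⟦ ψ ⟧q (y ∷ᵛ x) → Any (λ t → ⟦ ψ [ t ] ⟧q x) (testPoints (roots ψ))
  testPoint-witness ψ x {y} ψy =
    Any.map (λ same → subst id (sym (⟦ ψ [ _ ]⟧ x)) (⟦⟧q-resp-SameCell ψ x same ψy)) (testPoint-sameCell x (roots ψ) y)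

  ⟦eliminate⟧ : ∀ (ψ : QF (suc m)) x → ⟦ eliminate ψ ⟧q x ⇔ ∃ λ y → ⟦ ψ ⟧q (y ∷ᵛ x)
  ⟦eliminate⟧ ψ x = mk⇔
    (λ ψ[t] → let t , ψ[t]x = Any.satisfied (map⁻ (to (⟦⋁⟧ (map (ψ [_]) (testPoints (roots ψ))) x) ψ[t]))
              in evalE t x , subst id (⟦ ψ [ t ]⟧ x) ψ[t]x)
    (λ (y , ψy) → from (⟦⋁⟧ (map (ψ [_]) (testPoints (roots ψ))) x) (map⁺ (testPoint-witness ψ x ψy)))

  ⟦qe⟧ : ∀ (φ : Formula m) ρ → ⟦ qe φ ⟧q ρ ⇔ ⟦ φ ⟧ ρ
  ⟦qe⟧ (atom α) ρ = mk⇔ id id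
  ⟦qe⟧ (¬ᶠ φ) ρ   = mk⇔ (λ ¬ψ φρ → negate-sound (qe φ) ρ ¬ψ (from (⟦qe⟧ φ ρ) φρ))
                        (λ ¬φ → negate-complete (qe φ) ρ (¬φ ∘ to (⟦qe⟧ φ ρ)))
  ⟦qe⟧ (φ ∧ᶠ φ′) ρ = ⟦qe⟧ φ ρ ×-⇔ ⟦qe⟧ φ′ ρ
  ⟦qe⟧ (φ ∨ᶠ φ′) ρ = ⟦qe⟧ φ ρ ⊎-⇔ ⟦qe⟧ φ′ ρ
  ⟦qe⟧ (∃ᶠ φ) ρ   = mk⇔ (Product.map₂ (to (⟦qe⟧ φ _)) ∘ to (⟦eliminate⟧ (qe φ) ρ))
                        (from (⟦eliminate⟧ (qe φ) ρ) ∘ Product.map₂ (from (⟦qe⟧ φ _)))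
  ⟦qe⟧ {m} (∀ᶠ φ) ρ = mk⇔
    (λ no-counterexample y → to (⟦qe⟧ φ (y ∷ᵛ ρ)) (decidable-stable (decide ψ (y ∷ᵛ ρ)) λ ¬ψy →
       negate-sound (eliminate (negate ψ)) ρ no-counterexample
         (from (⟦eliminate⟧ (negate ψ) ρ) (y , negate-complete ψ (y ∷ᵛ ρ) ¬ψy))))
    (λ φ-everywhere → negate-complete (eliminate (negate ψ)) ρ λ counterexample →
       let y , ¬ψy = to (⟦eliminate⟧ (negate ψ) ρ) counterexample
       in negate-sound ψ (y ∷ᵛ ρ) ¬ψy (from (⟦qe⟧ φ (y ∷ᵛ ρ)) (φ-everywhere y)))
    where
    ψ : QF (suc m)
    ψ = qe φ

module Translations (R : Reals) where

  open Reals R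
  open Semantics R
  open RealArithmetic R
  open Evaluation R
  open QuantifierElimination R

  ⟦inUnit⟧ : ∀ (e : LinExp m) ρ → ⟦ inUnit e ⟧q ρ ≡ In01 (evalE e ρ)
  ⟦inUnit⟧ e ρ =
    cong₂ _×_ (cong (_≤ evalE e ρ) (evalE-0ᵉ ρ)) (cong (evalE e ρ ≤_) (trans (evalE-constᵉ 1ℚ ρ) fromℚ-1))

  ⟦cube⟧ : ∀ y (x : Fin n → ℝ) → ⟦ ⋀ (tabulate (inUnit ∘ var ∘ suc)) ⟧q (y ∷ᵛ x) ⇔ InCube x
  ⟦cube⟧ y x = ⇔.trans (⟦⋀⟧ (tabulate (inUnit ∘ var ∘ suc)) (y ∷ᵛ x)) (mk⇔
    (λ all i → subst id (in01-xᵢ i) (All.tabulate⁻ all i))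
    (λ cube → All.tabulate⁺ λ i → subst id (sym (in01-xᵢ i)) (cube i)))
    where
    in01-xᵢ : ∀ i → ⟦ inUnit (var (suc i)) ⟧q (y ∷ᵛ x) ≡ In01 (x i)
    in01-xᵢ i = trans (⟦inUnit⟧ (var (suc i)) (y ∷ᵛ x)) (cong In01 (evalE-var (suc i) (y ∷ᵛ x)))

  ⟦branch⟧ : ∀ (c : CondExp n) y x →
             ⟦ branch c ⟧q (y ∷ᵛ x) ⇔ (HoldsC (CondExp.cond c) x × evalE (CondExp.expr c) x ≡ y)
  ⟦branch⟧ (C ⊢ e) y x = mk⇔
    (λ (conds , y≤e , e≤y) → holds⇔ .to conds , ≤-antisym (subst₂ _≤_ e↑ y↑ e≤y) (subst₂ _≤_ y↑ e↑ y≤e))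
    (λ (holds , e≡y) → holds⇔ .from holds ,
                       inj₂ (trans y↑ (trans (sym e≡y) (sym e↑))) , inj₂ (trans e↑ (trans e≡y (sym y↑))))
    where
    y↑ : evalE (var zero) (y ∷ᵛ x) ≡ y
    y↑ = evalE-var zero (y ∷ᵛ x)
    e↑ : evalE (weaken e) (y ∷ᵛ x) ≡ evalE e x
    e↑ = evalE-weaken e (y ∷ᵛ x)
    weakened : ∀ α → evalI (mapIneq weaken α) (y ∷ᵛ x) ≡ evalI α x
    weakened α = evalI-mapIneq weaken α (y ∷ᵛ x) x (λ e → evalE-weaken e (y ∷ᵛ x))
    holds⇔ : ⟦ ⋀ (map (atom ∘ mapIneq weaken) C) ⟧q (y ∷ᵛ x) ⇔ HoldsC C x
    holds⇔ = ⇔.trans (⟦⋀⟧ (map (atom ∘ mapIneq weaken) C) (y ∷ᵛ x)) (mk⇔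
      (All.map (λ {α} → subst id (weakened α)) ∘ All.map⁻)
      (All.map⁺ ∘ All.map (λ {α} → subst id (sym (weakened α)))))

  ⟦graphFormula⟧ : ∀ (𝓕 : System n) x y → ⟦ graphFormula 𝓕 ⟧ (y ∷ᵛ x) ⇔
    (InCube x × In01 y × Any (λ c → HoldsC (CondExp.cond c) x × evalE (CondExp.expr c) x ≡ y) 𝓕)
  ⟦graphFormula⟧ 𝓕 x y = ⇔.trans (⇔.reflexive (⟦⌜ graphQF 𝓕 ⌝⟧ (y ∷ᵛ x)))
    (⟦cube⟧ y x ×-⇔ ⇔.reflexive (trans (⟦inUnit⟧ (var zero) (y ∷ᵛ x)) (cong In01 (evalE-var zero (y ∷ᵛ x))))
                ×-⇔ ⇔.trans (⟦⋁⟧ (map branch 𝓕) (y ∷ᵛ x)) (mk⇔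
                      (Any.map (λ {c} → to (⟦branch⟧ c y x)) ∘ map⁻)
                      (map⁺ ∘ Any.map (λ {c} → from (⟦branch⟧ c y x)))))

  graphFormula-defines : ∀ (f : (Fin n → ℝ) → ℝ) 𝓕 → Represents f 𝓕 → Defines f (graphFormula 𝓕)
  graphFormula-defines f 𝓕 (covers , agrees) x y = ⇔.trans (⟦graphFormula⟧ 𝓕 x y) (mk⇔
    (λ (cube , y∈I , on-branch) → let c , c∈𝓕 , holds , c≡y = find on-branch in
       cube , y∈I , trans (sym (agrees x cube c c∈𝓕 holds)) c≡y)
    (λ (cube , y∈I , fx≡y) → let c , c∈𝓕 , holds = covers x cube in
       cube , y∈I , lose c∈𝓕 (holds , trans (agrees x cube c c∈𝓕 holds) fx≡y)))

  branchesAt-sound : ∀ (ψ : QF (suc n)) ts {c} x → c ∈ branchesAt ψ ts → HoldsC (CondExp.cond c) x →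
                     ⟦ ψ ⟧q (evalE (CondExp.expr c) x ∷ᵛ x)
  branchesAt-sound ψ ts x c∈ holds with find (∈-concatMap⁻ (λ t → map (_⊢ t) (dnf (ψ [ t ]))) {xs = ts} c∈)
  ... | t , _ , c∈branches with ∈-map⁻ (_⊢ t) c∈branches
  ... | D , D∈ , refl = subst id (⟦ ψ [ t ]⟧ x) (from (⟦dnf⟧ (ψ [ t ]) x) (lose D∈ holds))

  branchesAt-complete : ∀ (ψ : QF (suc n)) ts x → Any (λ t → ⟦ ψ [ t ] ⟧q x) ts →
                        Any (λ c → HoldsC (CondExp.cond c) x) (branchesAt ψ ts)
  branchesAt-complete ψ ts x =
    concatMap⁺ (λ t → map (_⊢ t) (dnf (ψ [ t ]))) ∘ Any.map (λ {t} → map⁺ ∘ to (⟦dnf⟧ (ψ [ t ]) x))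

  representingSystem-represents : ∀ (f : (Fin n → ℝ) → ℝ) → MapsCube f → ∀ F → Defines f F →
                                  Represents f (representingSystem F)
  representingSystem-represents {n} f maps F defines = covers , agrees
    where
    ψ : QF (suc n)
    ψ = qe F
    covers : ∀ d → InCube d → ∃ λ c → c ∈ representingSystem F × HoldsC (CondExp.cond c) d
    covers d cube = find (branchesAt-complete ψ (testPoints (roots ψ)) d (testPoint-witness ψ d
      (from (⟦qe⟧ F _) (from (defines d (f d)) (cube , maps d cube , refl)))))
    agrees : ∀ d → InCube d → ∀ c → c ∈ representingSystem F → HoldsC (CondExp.cond c) d →
             evalE (CondExp.expr c) d ≡ f d
    agrees d cube c c∈ holds =
      sym (proj₂ (proj₂ (to (defines d _) (to (⟦qe⟧ F _) (branchesAt-sound ψ (testPoints (roots ψ)) d c∈ holds)))))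


proposition3 : (n : ℕ) →
    ((R : Reals) → (f : (Fin n → Reals.ℝ R) → Reals.ℝ R) → Semantics.MapsCube R f →
      Semantics.RepresentableBySystem R f ⇔ Semantics.GraphDefinable R f)
    × (Σ (System n → Formula (ℕ.suc n)) λ toFormula →
        (R : Reals) → (f : (Fin n → Reals.ℝ R) → Reals.ℝ R) → Semantics.MapsCube R f →
          (𝓕 : System n) → Semantics.Represents R f 𝓕 → Semantics.Defines R f (toFormula 𝓕))
    × (Σ (Formula (ℕ.suc n) → System n) λ toSystem →
        (R : Reals) → (f : (Fin n → Reals.ℝ R) → Reals.ℝ R) → Semantics.MapsCube R f →
          (F : Formula (ℕ.suc n)) → Semantics.Defines R f F → Semantics.Represents R f (toSystem F))
proposition3 n =
  (λ R f maps → mk⇔ (λ (𝓕 , represents) → graphFormula 𝓕 , graphFormula-defines R f 𝓕 represents)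
                    (λ (F , defines) → representingSystem F , representingSystem-represents R f maps F defines)) ,
  (graphFormula , λ R f _ → graphFormula-defines R f) ,
  (representingSystem , λ R → representingSystem-represents R)
  where open Translations
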